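{- Let $G$ be a connected graph and let $T$ be a treedepth decomposition of $G$ of depth $k$. Suppose the root vertex $v$ of $T$ has exactly one child $v'$ in $T$. Then there exists a treedepth decomposition of $G$ of depth at most $k$ whose root is $v'$.
   Context: All graphs are finite and simple. A treedepth decomposition of a graph $G=(V,E)$ is a rooted forest $F$ with node set $V$ such that for each edge $\{u,w\}\in E$, either $u$ is an ancestor of $w$ or $w$ is an ancestor of $u$ in $F$. The depth of a rooted forest is the maximum number of vertices on a path from a root to a leaf. -}

module Defs where

open import Data.Nat using (ℕ; zero; suc; _≤_)
open import Data.Fin using (Fin)
open import Data.Maybe using (Maybe; just; nothing)
open import Data.Product using (Σ; ∃; _×_; _,_)
open import Data.Sum using (_⊎_)
open import Data.Empty using (⊥)
open import Relation.Nullary using (¬_)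
open import Relation.Binary.PropositionalEquality using (_≡_)

record Graph (n : ℕ) : Set₁ where
  field
    Adj   : Fin n → Fin n → Set
    sym   : ∀ {u w} → Adj u w → Adj w u
    irrefl : ∀ {u} → ¬ Adj u u
open Graph public

data Reach {n : ℕ} (G : Graph n) : Fin n → Fin n → Set where
  here : ∀ {u} → Reach G u u
  step : ∀ {u w x} → Adj G u w → Reach G w x → Reach G u x

Connected : {n : ℕ} → Graph n → Set
Connected G = ∀ u w → Reach G u w

-- Parent maps on Fin n (nothing = root).
Parent : ℕ → Set
Parent n = Fin n → Maybe (Fin n)

-- Level p v d : the path from the root down to v has exactly d vertices.
data Level {n : ℕ} (p : Parent n) : Fin n → ℕ → Set where
  root : ∀ {v} → p v ≡ nothing → Level p v 1
  down : ∀ {v u d} → p v ≡ just u → Level p u d → Level p v (suc d)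

data Anc {n : ℕ} (p : Parent n) : Fin n → Fin n → Set where
  par : ∀ {u w} → p w ≡ just u → Anc p u w
  up  : ∀ {u w x} → p w ≡ just x → Anc p u x → Anc p u w

-- A rooted forest on node set Fin n: a parent map in which every vertex
-- reaches a root after finitely many steps (i.e. no cycles).
record RootedForest (n : ℕ) : Set where
  field
    parent : Parent n
    leveled : ∀ v → ∃ λ d → Level parent v d
open RootedForest public

IsTDD : {n : ℕ} → Graph n → RootedForest n → Set
IsTDD G F = ∀ u w → Adj G u w → Anc (parent F) u w ⊎ Anc (parent F) w u

DepthAtMost : {n : ℕ} → RootedForest n → ℕ → Set
DepthAtMost F k = ∀ v d → Level (parent F) v d → d ≤ k

HasDepth : {n : ℕ} → RootedForest n → ℕ → Set
HasDepth F k = DepthAtMost F k × (∃ λ v → Level (parent F) v k)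

IsRootOf : {n : ℕ} → Fin n → RootedForest n → Set
IsRootOf r F = parent F r ≡ nothing × (∀ u → parent F u ≡ nothing → u ≡ r)

-- The transposition of v and v′ relabels T into an isomorphic rooted tree
-- rooted at v′, so every level, and hence the depth, is unchanged. It is
-- still a treedepth decomposition: v is an ancestor of every other vertex,
-- and since v′ is the only child of v, v′ is an ancestor of every vertex
-- other than v and v′. So v and v′ are comparable with everything, and the
-- relabelling fixes all other vertices.
module Submission where

open import Defs hiding (sym)
open import Data.Nat using (ℕ)
open import Data.Fin using (Fin; _≟_)
open import Data.Fin.Permutation
  using (Permutation; _⟨$⟩ʳ_; _⟨$⟩ˡ_; inverseˡ; inverseʳ; transpose)
import Data.Fin.Permutation.Components as Components
open import Data.Maybe using (just; nothing; map)
open import Data.Maybe.Properties using (map-nothing; map-just)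
open import Data.Product using (Σ; _×_; _,_; proj₂)
open import Data.Sum using (_⊎_; inj₁; inj₂)
import Data.Sum as Sum
open import Data.Empty using (⊥-elim)
open import Function using (_∘′_)
open import Relation.Nullary using (yes; no)
open import Relation.Binary.PropositionalEquality
  using (_≡_; _≢_; refl; sym; trans; cong; subst; subst₂; module ≡-Reasoning)

private
  variable
    n : ℕ

Comparable : Parent n → Fin n → Fin n → Set
Comparable p a b = Anc p a b ⊎ Anc p b a

adjacent-distinct : ∀ (G : Graph n) {u w} → Adj G u w → u ≢ w
adjacent-distinct G adj refl = irrefl G adj

transpose-moved-or-fixed : ∀ (i j k : Fin n) →
  let t = Components.transpose i j k in (t ≡ i ⊎ t ≡ j) ⊎ t ≡ k
transpose-moved-or-fixed i j k with k ≟ i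
... | yes _ = inj₁ (inj₂ refl)
... | no _ with k ≟ j
...   | yes _ = inj₁ (inj₁ refl)
...   | no _ = inj₂ refl

transpose-matchˡ : ∀ (i j : Fin n) → Components.transpose i j i ≡ j
transpose-matchˡ i j with i ≟ i
... | yes _ = refl
... | no i≢i = ⊥-elim (i≢i refl)

transpose-injective : ∀ (i j : Fin n) {u w} →
  Components.transpose i j u ≡ Components.transpose i j w → u ≡ w
transpose-injective i j {u} {w} eq = begin
  u                ≡⟨ transpose-inverse j i ⟨
  τ (τ′ u)         ≡⟨ cong τ eq ⟩
  τ (τ′ w)         ≡⟨ transpose-inverse j i ⟩
  w                ∎
  where
  open ≡-Reasoning
  open Components using (transpose-inverse)
  τ τ′ : Fin _ → Fin _
  τ  = Components.transpose j i
  τ′ = Components.transpose i j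

module _ (π : Permutation n n) where

  relabelParent : Parent n → Parent n
  relabelParent p w = map (π ⟨$⟩ʳ_) (p (π ⟨$⟩ˡ w))

  relabelParent-⟨$⟩ʳ : ∀ p x → relabelParent p (π ⟨$⟩ʳ x) ≡ map (π ⟨$⟩ʳ_) (p x)
  relabelParent-⟨$⟩ʳ p x = cong (λ y → map (π ⟨$⟩ʳ_) (p y)) (inverseˡ π)

  private
    map-⟨$⟩ʳ-nothing : ∀ {m} → map (π ⟨$⟩ʳ_) m ≡ nothing → m ≡ nothing
    map-⟨$⟩ʳ-nothing {nothing} _ = refl

    map-⟨$⟩ʳ-just : ∀ {m u} → map (π ⟨$⟩ʳ_) m ≡ just u → m ≡ just (π ⟨$⟩ˡ u)
    map-⟨$⟩ʳ-just {just x} refl = cong just (sym (inverseˡ π))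

  module _ {p : Parent n} where

    Level-relabel : ∀ {x d} → Level p x d → Level (relabelParent p) (π ⟨$⟩ʳ x) d
    Level-relabel {x} (root e) = root (trans (relabelParent-⟨$⟩ʳ p x) (map-nothing e))
    Level-relabel {x} (down e l) =
      down (trans (relabelParent-⟨$⟩ʳ p x) (map-just e)) (Level-relabel l)

    Level-unrelabel : ∀ {w d} → Level (relabelParent p) w d → Level p (π ⟨$⟩ˡ w) d
    Level-unrelabel (root e) = root (map-⟨$⟩ʳ-nothing e)
    Level-unrelabel (down e l) = down (map-⟨$⟩ʳ-just e) (Level-unrelabel l)

    Anc-relabel : ∀ {a b} → Anc p a b → Anc (relabelParent p) (π ⟨$⟩ʳ a) (π ⟨$⟩ʳ b)
    Anc-relabel {b = b} (par e) = par (trans (relabelParent-⟨$⟩ʳ p b) (map-just e))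
    Anc-relabel {b = b} (up e a) =
      up (trans (relabelParent-⟨$⟩ʳ p b) (map-just e)) (Anc-relabel a)

    Comparable-relabel : ∀ {u w} → Comparable p (π ⟨$⟩ˡ u) (π ⟨$⟩ˡ w) →
                         Comparable (relabelParent p) u w
    Comparable-relabel (inj₁ a) = inj₁ (subst₂ (Anc _) (inverseʳ π) (inverseʳ π) (Anc-relabel a))
    Comparable-relabel (inj₂ a) = inj₂ (subst₂ (Anc _) (inverseʳ π) (inverseʳ π) (Anc-relabel a))

  relabel : RootedForest n → RootedForest n
  relabel F .parent = relabelParent (parent F)
  relabel F .leveled w with leveled F (π ⟨$⟩ˡ w)
  ... | d , l = d , subst (λ x → Level _ x d) (inverseʳ π) (Level-relabel l)

  module _ (F : RootedForest n) where

    relabel-depthAtMost : ∀ {k} → DepthAtMost F k → DepthAtMost (relabel F) k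
    relabel-depthAtMost depth w d l = depth _ d (Level-unrelabel l)

    relabel-isRootOf : ∀ {r} → IsRootOf r F → IsRootOf (π ⟨$⟩ʳ r) (relabel F)
    relabel-isRootOf {r} (r-root , unique) =
        trans (relabelParent-⟨$⟩ʳ (parent F) r) (map-nothing r-root)
      , λ u e → trans (sym (inverseʳ π))
                      (cong (π ⟨$⟩ʳ_) (unique _ (map-⟨$⟩ʳ-nothing e)))

    relabel-isTDD : ∀ (G : Graph n) →
      (∀ u w → Adj G u w → Comparable (parent F) (π ⟨$⟩ˡ u) (π ⟨$⟩ˡ w)) →
      IsTDD G (relabel F)
    relabel-isTDD G comparable u w adj = Comparable-relabel (comparable u w adj)

module _ {p : Parent n} {r : Fin n} where

  uniqueRoot-Anc : (∀ u → p u ≡ nothing → u ≡ r) →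
                   ∀ {x d} → Level p x d → x ≢ r → Anc p r x
  uniqueRoot-Anc unique {x} (root e) x≢r = ⊥-elim (x≢r (unique x e))
  uniqueRoot-Anc unique (down {u = u} e l) _ with u ≟ r
  ... | yes refl = par e
  ... | no u≢r = up e (uniqueRoot-Anc unique l u≢r)

  onlyChild-Anc : ∀ {c} → (∀ w → p w ≡ just r → w ≡ c) →
                  ∀ {x} → Anc p r x → x ≢ c → Anc p c x
  onlyChild-Anc only (par e) x≢c = ⊥-elim (x≢c (only _ e))
  onlyChild-Anc {c} only (up {x = y} e a) _ with y ≟ c
  ... | yes refl = par e
  ... | no y≢c = up e (onlyChild-Anc only a y≢c)

module _ (F : RootedForest n) {r c : Fin n} (r-root : IsRootOf r F)
         (c-child : parent F c ≡ just r) (only : ∀ w → parent F w ≡ just r → w ≡ c) where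

  root-Anc : ∀ {x} → x ≢ r → Anc (parent F) r x
  root-Anc {x} = uniqueRoot-Anc (proj₂ r-root) (proj₂ (leveled F x))

  rootOrOnlyChild-comparable : ∀ {x y} → x ≡ r ⊎ x ≡ c → x ≢ y → Comparable (parent F) x y
  rootOrOnlyChild-comparable (inj₁ refl) x≢y = inj₁ (root-Anc (x≢y ∘′ sym))
  rootOrOnlyChild-comparable {y = y} (inj₂ refl) x≢y with y ≟ r
  ... | yes refl = inj₂ (par c-child)
  ... | no y≢r = inj₁ (onlyChild-Anc only (root-Anc y≢r) (x≢y ∘′ sym))

  transposed-comparable : ∀ (G : Graph n) → IsTDD G F → ∀ u w → Adj G u w →
    Comparable (parent F) (Components.transpose c r u) (Components.transpose c r w)
  transposed-comparable G tdd u w adj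
    with transpose-moved-or-fixed c r u | transpose-moved-or-fixed c r w
  ... | inj₁ moved | _ =
    rootOrOnlyChild-comparable (Sum.swap moved)
      (adjacent-distinct G adj ∘′ transpose-injective c r)
  ... | inj₂ _ | inj₁ moved = Sum.swap
    (rootOrOnlyChild-comparable (Sum.swap moved)
      (adjacent-distinct G adj ∘′ sym ∘′ transpose-injective c r))
  ... | inj₂ u-fixed | inj₂ w-fixed =
    subst₂ (Comparable (parent F)) (sym u-fixed) (sym w-fixed) (tdd u w adj)

proposition1 : {n : ℕ} (G : Graph n) → Connected G →
    (T : RootedForest n) (k : ℕ) → IsTDD G T → HasDepth T k →
    (v v′ : Fin n) → IsRootOf v T →
    parent T v′ ≡ just v → (∀ w → parent T w ≡ just v → w ≡ v′) →
    Σ (RootedForest n) λ F → IsTDD G F × DepthAtMost F k × IsRootOf v′ F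
proposition1 G _ T k tdd (depth , _) v v′ v-root v′-child only =
    relabel π T
  , relabel-isTDD π T G (transposed-comparable T v-root v′-child only G tdd)
  , relabel-depthAtMost π T depth
  , subst (λ r → IsRootOf r (relabel π T)) (transpose-matchˡ v v′)
          (relabel-isRootOf π T v-root)
  where
  π : Permutation _ _
  π = transpose v v′
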